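{- Let $\Gamma$ be a set of sequents and $\Gamma^\exists=\{A^\exists\Rightarrow B^\exists\mid A\Rightarrow B\in\Gamma\}$. If $\mathbf{HA}+\Gamma^\exists\nvdash\top\Rightarrow\bot$, then $\mathbf{BA}+\Gamma^\exists\nvdash\mathbf{MRDP}^w$, i.e. there is a $\Sigma_1$ formula $A$ such that for no $\exists_1^+$ formula $B$ with the same free variables as $A$ does $\mathbf{BA}+\Gamma^\exists$ prove $\top\Rightarrow(A\to B)\land(B\to A)$.
   Context: Basic Arithmetic $\mathbf{BA}$ (Ruitenburg) is the following theory of sequents $A\Rightarrow B$ in the language $\{0,S,+,\cdot\}$, where formulas are built from atomic formulas ($s=t$, $\top$, $\bot$) by $\land,\lor,\exists x$ and the former $\forall\mathbf x(A\to B)$ ($\mathbf x$ a finite, possibly empty, sequence of variables; empty gives $A\to B$). Logical part (Basic Predicate Calculus): axioms $A\Rightarrow A$; $A\Rightarrow\top$; $\bot\Rightarrow A$; $A\land(B\lor C)\Rightarrow(A\land B)\lor(A\land C)$; $A\land\exists xB\Rightarrow\exists x(A\land B)$ ($x$ not free in $A$); $\top\Rightarrow x=x$; $x=y\land A\Rightarrow A[x/y]$ ($A$ atomic); $\forall\mathbf x(A\to B)\land\forall\mathbf x(B\to C)\Rightarrow\forall\mathbf x(A\to C)$; $\forall\mathbf x(A\to B)\land\forall\mathbf x(A\to C)\Rightarrow\forall\mathbf x(A\to B\land C)$; $\forall\mathbf x(B\to A)\land\forall\mathbf x(C\to A)\Rightarrow\forall\mathbf x(B\lor C\to A)$; $\forall\mathbf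 x(A\to B)\Rightarrow\forall\mathbf x(A[\mathbf x/\mathbf t]\to B[\mathbf x/\mathbf t])$; $\forall\mathbf x(A\to B)\Rightarrow\forall\mathbf y(A\to B)$ (no variable of $\mathbf y$ free on the left); $\forall\mathbf yx(B\to A)\Rightarrow\forall\mathbf y(\exists xB\to A)$ ($x$ not free in $A$); rules: transitivity; $A\Rightarrow B\land C$ iff $A\Rightarrow B$ and $A\Rightarrow C$; $B\lor C\Rightarrow A$ iff $B\Rightarrow A$ and $C\Rightarrow A$; term substitution; $\exists xB\Rightarrow A$ iff $B\Rightarrow A$ ($x$ not free in $A$); from $A\land B\Rightarrow C$ infer $A\Rightarrow\forall\mathbf x(B\to C)$ (no variable of $\mathbf x$ free in $A$). Arithmetic part: $Sx=0\Rightarrow\bot$; $Sx=Sy\Rightarrow x=y$; $x+0=x$; $x+Sy=S(x+y)$; $x\cdot0=0$; $x\cdot Sy=x\cdot y+x$; induction axiom schema $\forall\mathbf yx(A\to A[x/Sx])\Rightarrow\forall\mathbf yx(A[x/0]\to A)$; induction rule: from $A\Rightarrow A[x/Sx]$ infer $A[x/0]\Rightarrow A$. Heyting arithmetic $\mathbf{HA}$ is $\mathbf{BA}$ plus the schema $(\top\to A)\Rightarrow A$ (i.e. $\mathbf{BA}$ over intuitionistic logic). For a set $\Delta$ of sequents, $T+\Delta$ is $T$ with these sequents added as axioms. Positive part: $A^\exists=A$ for atomic $A$; $(A'\circ A'')^\exists=A'^\exists\circ A''^\exists$ for $\circ\in\{\land,\lor\}$; $(\exists uA')^\exists=\exists uA'^\exists$;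 $(\forall\mathbf u(A'\to A''))^\exists=\top$. $s<t$ abbreviates $\exists x(s+Sx=t)$. $\Delta_0$: smallest class containing atomic formulas, closed under $\land,\lor,\to$ and bounded quantifiers $\exists x(x<s\land A)$, $\forall x(x<s\to A)$; $\Sigma_1$: $\exists\mathbf xA$ with $A\in\Delta_0$; $\exists_1^+$: $\exists\mathbf xA$ with $A$ quantifier-free without $\to$. -}

module Defs where

open import Data.Nat using (ℕ; zero; suc; _+_; _∸_; _<ᵇ_; _≡ᵇ_)
open import Data.Bool using (if_then_else_)
open import Data.Sum using (_⊎_)
open import Relation.Binary.PropositionalEquality using (_≡_)

-- Syntax of arithmetic (language {0, S, +, ·}), de Bruijn variables.
-- Formulas are open in an infinite ambient context of variables
-- var 0, var 1, ... ; binders shift indices.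

infixl 7 _`·_
infixl 6 _`+_

data Term : Set where
  var  : ℕ → Term
  `0   : Term
  `S   : Term → Term
  _`+_ : Term → Term → Term
  _`·_ : Term → Term → Term

infix  4 _≐_
infixr 3 _∧'_
infixr 2 _∨'_
infix  1 ∀[_]_⟶_
infixr 1 _⊃_

data Form : Set where
  _≐_      : Term → Term → Form
  ⊤' ⊥'    : Form
  _∧'_     : Form → Form → Form
  _∨'_     : Form → Form → Form
  ∃'       : Form → Form
  -- ∀[ n ] A ⟶ B  is  ∀x₁…xₙ (A → B); the n bound variables are the
  -- indices 0 … n-1 inside A and B (the last-listed variable is index 0).
  ∀[_]_⟶_ : ℕ → Form → Form → Form

_⊃_ : Form → Form → Form
A ⊃ B = ∀[ 0 ] A ⟶ B

Subst : Set
Subst = ℕ → Term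

substT : Subst → Term → Term
substT σ (var i)  = σ i
substT σ `0       = `0
substT σ (`S t)   = `S (substT σ t)
substT σ (s `+ t) = substT σ s `+ substT σ t
substT σ (s `· t) = substT σ s `· substT σ t

wkT : Term → Term
wkT = substT (λ i → var (suc i))

lift : Subst → Subst
lift σ zero    = var zero
lift σ (suc i) = wkT (σ i)

liftN : ℕ → Subst → Subst
liftN zero    σ = σ
liftN (suc n) σ = lift (liftN n σ)

infixl 8 _[_]

_[_] : Form → Subst → Form
(s ≐ t) [ σ ]           = substT σ s ≐ substT σ t
⊤' [ σ ]                = ⊤'
⊥' [ σ ]                = ⊥'
(A ∧' B) [ σ ]          = A [ σ ] ∧' B [ σ ]
(A ∨' B) [ σ ]          = A [ σ ] ∨' B [ σ ]
∃' A [ σ ]              = ∃' (A [ lift σ ])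
(∀[ n ] A ⟶ B) [ σ ]   = ∀[ n ] (A [ liftN n σ ]) ⟶ (B [ liftN n σ ])

-- shifting all free variables by n (used for "x not free in A")
wkN : ℕ → Form → Form
wkN n A = A [ (λ i → var (n + i)) ]

wk : Form → Form
wk = wkN 1

sb : ℕ → Term → Subst
sb k t i = if i ≡ᵇ k then t else var i

bnd : ℕ → (ℕ → Term) → Subst
bnd n τ i = if i <ᵇ n then τ i else var i

-- rebinding ∀x̄ to ∀ȳ (|x̄| = n, |ȳ| = m): each old bound variable i < n
-- becomes the variable r i (bound if r i < m, free otherwise); outer
-- variables are shifted past the m new binders (so the new binders are
-- not free on the left).
rb : ℕ → ℕ → (ℕ → ℕ) → Subst
rb n m r i = if i <ᵇ n then var (r i) else var (i ∸ n + m)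

data OccT (i : ℕ) : Term → Set where
  here : OccT i (var i)
  inS  : ∀ {t} → OccT i t → OccT i (`S t)
  +ˡ   : ∀ {s t} → OccT i s → OccT i (s `+ t)
  +ʳ   : ∀ {s t} → OccT i t → OccT i (s `+ t)
  ·ˡ   : ∀ {s t} → OccT i s → OccT i (s `· t)
  ·ʳ   : ∀ {s t} → OccT i t → OccT i (s `· t)

data Free : ℕ → Form → Set where
  ≐ˡ  : ∀ {i s t} → OccT i s → Free i (s ≐ t)
  ≐ʳ  : ∀ {i s t} → OccT i t → Free i (s ≐ t)
  ∧ˡ  : ∀ {i A B} → Free i A → Free i (A ∧' B)
  ∧ʳ  : ∀ {i A B} → Free i B → Free i (A ∧' B)
  ∨ˡ  : ∀ {i A B} → Free i A → Free i (A ∨' B)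
  ∨ʳ  : ∀ {i A B} → Free i B → Free i (A ∨' B)
  ex  : ∀ {i A} → Free (suc i) A → Free i (∃' A)
  ∀ˡ  : ∀ {i n A B} → Free (n + i) A → Free i (∀[ n ] A ⟶ B)
  ∀ʳ  : ∀ {i n A B} → Free (n + i) B → Free i (∀[ n ] A ⟶ B)

SameFV : Form → Form → Set
SameFV A B = ∀ i → (Free i A → Free i B) × (Free i B → Free i A)
  where open import Data.Product using (_×_)

data Atomic : Form → Set where
  at-≐ : ∀ {s t} → Atomic (s ≐ t)
  at-⊤ : Atomic ⊤'
  at-⊥ : Atomic ⊥'

_<'_ : Term → Term → Form
s <' t = ∃' (wkT s `+ `S (var 0) ≐ wkT t)

data Δ₀ : Form → Set where
  d-at   : ∀ {A} → Atomic A → Δ₀ A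
  d-∧    : ∀ {A B} → Δ₀ A → Δ₀ B → Δ₀ (A ∧' B)
  d-∨    : ∀ {A B} → Δ₀ A → Δ₀ B → Δ₀ (A ∨' B)
  d-⊃    : ∀ {A B} → Δ₀ A → Δ₀ B → Δ₀ (A ⊃ B)
  d-b∃   : ∀ {s A} → Δ₀ A → Δ₀ (∃' ((var 0 <' wkT s) ∧' A))
  d-b∀   : ∀ {s A} → Δ₀ A → Δ₀ (∀[ 1 ] (var 0 <' wkT s) ⟶ A)

data Σ₁ : Form → Set where
  σ-base : ∀ {A} → Δ₀ A → Σ₁ A
  σ-∃    : ∀ {A} → Σ₁ A → Σ₁ (∃' A)

data QF⁺ : Form → Set where
  q-at : ∀ {A} → Atomic A → QF⁺ A
  q-∧  : ∀ {A B} → QF⁺ A → QF⁺ B → QF⁺ (A ∧' B)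
  q-∨  : ∀ {A B} → QF⁺ A → QF⁺ B → QF⁺ (A ∨' B)

data ∃₁⁺ : Form → Set where
  e-base : ∀ {A} → QF⁺ A → ∃₁⁺ A
  e-∃    : ∀ {A} → ∃₁⁺ A → ∃₁⁺ (∃' A)

_^∃ : Form → Form
(s ≐ t) ^∃        = s ≐ t
⊤' ^∃             = ⊤'
⊥' ^∃             = ⊥'
(A ∧' B) ^∃       = A ^∃ ∧' B ^∃
(A ∨' B) ^∃       = A ^∃ ∨' B ^∃
∃' A ^∃           = ∃' (A ^∃)
(∀[ n ] A ⟶ B) ^∃ = ⊤'

infix 0 _⇒_
data Seq : Set where
  _⇒_ : Form → Form → Seq

Sequents : Set₁
Sequents = Seq → Set

_∪_ : Sequents → Sequents → Sequents
(Δ ∪ Δ') s = Δ s ⊎ Δ' s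

data _^∃s (Γ : Sequents) : Sequents where
  pos : ∀ {A B} → Γ (A ⇒ B) → (Γ ^∃s) (A ^∃ ⇒ B ^∃)

data HA-ax : Sequents where
  ⊤⊃ : ∀ {A} → HA-ax ((⊤' ⊃ A) ⇒ A)

infix -1 BA+_⊢_
data BA+_⊢_ (Δ : Sequents) : Seq → Set where
  hyp       : ∀ {s} → Δ s → BA+ Δ ⊢ s
  idax      : ∀ {A} → BA+ Δ ⊢ A ⇒ A
  ⊤ax       : ∀ {A} → BA+ Δ ⊢ A ⇒ ⊤'
  ⊥ax       : ∀ {A} → BA+ Δ ⊢ ⊥' ⇒ A
  distr     : ∀ {A B C} → BA+ Δ ⊢ A ∧' (B ∨' C) ⇒ (A ∧' B) ∨' (A ∧' C)
  frob      : ∀ {A B} → BA+ Δ ⊢ A ∧' ∃' B ⇒ ∃' (wk A ∧' B)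
  eq-refl   : ∀ {i} → BA+ Δ ⊢ ⊤' ⇒ var i ≐ var i
  eq-sub    : ∀ {i j A} → Atomic A →
              BA+ Δ ⊢ (var i ≐ var j) ∧' A ⇒ A [ sb i (var j) ]
  ⊃-trans   : ∀ {n A B C} →
              BA+ Δ ⊢ (∀[ n ] A ⟶ B) ∧' (∀[ n ] B ⟶ C) ⇒ ∀[ n ] A ⟶ C
  ⊃-∧       : ∀ {n A B C} →
              BA+ Δ ⊢ (∀[ n ] A ⟶ B) ∧' (∀[ n ] A ⟶ C) ⇒ ∀[ n ] A ⟶ (B ∧' C)
  ⊃-∨       : ∀ {n A B C} →
              BA+ Δ ⊢ (∀[ n ] B ⟶ A) ∧' (∀[ n ] C ⟶ A) ⇒ ∀[ n ] (B ∨' C) ⟶ A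
  ⊃-inst    : ∀ {n A B} (τ : ℕ → Term) →
              BA+ Δ ⊢ (∀[ n ] A ⟶ B) ⇒ ∀[ n ] A [ bnd n τ ] ⟶ B [ bnd n τ ]
  ⊃-rebind  : ∀ {n A B} (m : ℕ) (r : ℕ → ℕ) →
              BA+ Δ ⊢ (∀[ n ] A ⟶ B) ⇒ ∀[ m ] A [ rb n m r ] ⟶ B [ rb n m r ]
  ⊃-∃       : ∀ {m A B} →
              BA+ Δ ⊢ (∀[ suc m ] B ⟶ wk A) ⇒ ∀[ m ] ∃' B ⟶ A
  trans     : ∀ {A B C} → BA+ Δ ⊢ A ⇒ B → BA+ Δ ⊢ B ⇒ C → BA+ Δ ⊢ A ⇒ C
  ∧I        : ∀ {A B C} → BA+ Δ ⊢ A ⇒ B → BA+ Δ ⊢ A ⇒ C → BA+ Δ ⊢ A ⇒ B ∧' C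
  ∧E₁       : ∀ {A B C} → BA+ Δ ⊢ A ⇒ B ∧' C → BA+ Δ ⊢ A ⇒ B
  ∧E₂       : ∀ {A B C} → BA+ Δ ⊢ A ⇒ B ∧' C → BA+ Δ ⊢ A ⇒ C
  ∨I        : ∀ {A B C} → BA+ Δ ⊢ B ⇒ A → BA+ Δ ⊢ C ⇒ A → BA+ Δ ⊢ B ∨' C ⇒ A
  ∨E₁       : ∀ {A B C} → BA+ Δ ⊢ B ∨' C ⇒ A → BA+ Δ ⊢ B ⇒ A
  ∨E₂       : ∀ {A B C} → BA+ Δ ⊢ B ∨' C ⇒ A → BA+ Δ ⊢ C ⇒ A
  tsubst    : ∀ {A B} (k : ℕ) (t : Term) →
              BA+ Δ ⊢ A ⇒ B → BA+ Δ ⊢ A [ sb k t ] ⇒ B [ sb k t ]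
  ∃I        : ∀ {A B} → BA+ Δ ⊢ B ⇒ wk A → BA+ Δ ⊢ ∃' B ⇒ A
  ∃E        : ∀ {A B} → BA+ Δ ⊢ ∃' B ⇒ A → BA+ Δ ⊢ B ⇒ wk A
  ⊃I        : ∀ {n A B C} → BA+ Δ ⊢ wkN n A ∧' B ⇒ C →
              BA+ Δ ⊢ A ⇒ ∀[ n ] B ⟶ C
  S≢0       : BA+ Δ ⊢ `S (var 0) ≐ `0 ⇒ ⊥'
  S-inj     : BA+ Δ ⊢ `S (var 0) ≐ `S (var 1) ⇒ var 0 ≐ var 1
  +0        : BA+ Δ ⊢ ⊤' ⇒ var 0 `+ `0 ≐ var 0
  +S        : BA+ Δ ⊢ ⊤' ⇒ var 0 `+ `S (var 1) ≐ `S (var 0 `+ var 1)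
  ·0        : BA+ Δ ⊢ ⊤' ⇒ var 0 `· `0 ≐ `0
  ·S        : BA+ Δ ⊢ ⊤' ⇒ var 0 `· `S (var 1) ≐ var 0 `· var 1 `+ var 0
  ind-ax    : ∀ {m A} →
              BA+ Δ ⊢ (∀[ suc m ] A ⟶ A [ sb 0 (`S (var 0)) ])
                    ⇒ ∀[ suc m ] A [ sb 0 `0 ] ⟶ A
  ind-rule  : ∀ {A} (k : ℕ) → BA+ Δ ⊢ A ⇒ A [ sb k (`S (var k)) ] →
              BA+ Δ ⊢ A [ sb k `0 ] ⇒ A

HA+_⊢_ : Sequents → Seq → Set
HA+ Δ ⊢ s = BA+ (HA-ax ∪ Δ) ⊢ s

-- Translate every implication ∀x̄(A → B) of depth k + 1 into the conjunction of
-- ∀x̄(A⁽ᵏ⁾ → B⁽ᵏ⁾) with its own depth-k translation, and every implication of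
-- depth 0 into ⊤.  This turns each BA-derivation into a derivation of the
-- translated sequent from the translated axioms, and it fixes all
-- implication-free formulas, in particular Γ^∃ and every ∃₁⁺ formula.  If BA + Γ^∃ proved ¬(x = 0) ↔ B with
-- B ∈ ∃₁⁺, the depth-2 translation would give HA + Γ^∃ ⊢ ⊤ → B and
-- ⊢ B → ¬(x = 0), hence ¬(0 = 0), which is inconsistent.
module Submission where

open import Defs
open import Data.Nat using (ℕ; zero; suc)
open import Data.Product using (Σ; _×_; _,_)
open import Data.Sum using (inj₁; inj₂)
open import Relation.Nullary using (¬_)
open import Relation.Binary.PropositionalEquality using (_≡_; refl; sym; cong; cong₂)

mutual
  depth : ℕ → Form → Form
  depth k (s ≐ t)         = s ≐ t
  depth k ⊤'              = ⊤'
  depth k ⊥'              = ⊥'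
  depth k (A ∧' B)        = depth k A ∧' depth k B
  depth k (A ∨' B)        = depth k A ∨' depth k B
  depth k (∃' A)          = ∃' (depth k A)
  depth k (∀[ n ] A ⟶ B) = depth-∀ k n A B

  depth-∀ : ℕ → ℕ → Form → Form → Form
  depth-∀ zero    n A B = ⊤'
  depth-∀ (suc k) n A B = (∀[ n ] depth k A ⟶ depth k B) ∧' depth-∀ k n A B

depthSeq : ℕ → Seq → Seq
depthSeq k (A ⇒ B) = depth k A ⇒ depth k B

mutual
  depth-[] : ∀ k A σ → depth k (A [ σ ]) ≡ depth k A [ σ ]
  depth-[] k (s ≐ t)         σ = refl
  depth-[] k ⊤'              σ = refl
  depth-[] k ⊥'              σ = refl
  depth-[] k (A ∧' B)        σ = cong₂ _∧'_ (depth-[] k A σ) (depth-[] k B σ)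
  depth-[] k (A ∨' B)        σ = cong₂ _∨'_ (depth-[] k A σ) (depth-[] k B σ)
  depth-[] k (∃' A)          σ = cong ∃' (depth-[] k A (lift σ))
  depth-[] k (∀[ n ] A ⟶ B) σ = depth-∀-[] k n A B σ

  depth-∀-[] : ∀ k n A B σ →
    depth-∀ k n (A [ liftN n σ ]) (B [ liftN n σ ]) ≡ depth-∀ k n A B [ σ ]
  depth-∀-[] zero    n A B σ = refl
  depth-∀-[] (suc k) n A B σ =
    cong₂ _∧'_ (cong₂ (∀[_]_⟶_ n) (depth-[] k A (liftN n σ)) (depth-[] k B (liftN n σ)))
               (depth-∀-[] k n A B σ)

depth-^∃ : ∀ k A → depth k (A ^∃) ≡ A ^∃
depth-^∃ k (s ≐ t)         = refl
depth-^∃ k ⊤'              = refl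
depth-^∃ k ⊥'              = refl
depth-^∃ k (A ∧' B)        = cong₂ _∧'_ (depth-^∃ k A) (depth-^∃ k B)
depth-^∃ k (A ∨' B)        = cong₂ _∨'_ (depth-^∃ k A) (depth-^∃ k B)
depth-^∃ k (∃' A)          = cong ∃' (depth-^∃ k A)
depth-^∃ k (∀[ n ] A ⟶ B) = refl

depth-QF⁺ : ∀ k {A} → QF⁺ A → depth k A ≡ A
depth-QF⁺ k (q-at at-≐) = refl
depth-QF⁺ k (q-at at-⊤) = refl
depth-QF⁺ k (q-at at-⊥) = refl
depth-QF⁺ k (q-∧ p q)   = cong₂ _∧'_ (depth-QF⁺ k p) (depth-QF⁺ k q)
depth-QF⁺ k (q-∨ p q)   = cong₂ _∨'_ (depth-QF⁺ k p) (depth-QF⁺ k q)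

depth-∃₁⁺ : ∀ k {A} → ∃₁⁺ A → depth k A ≡ A
depth-∃₁⁺ k (e-base q) = depth-QF⁺ k q
depth-∃₁⁺ k (e-∃ e)    = cong ∃' (depth-∃₁⁺ k e)

module _ {Δ : Sequents} where

  ⊢-cong : ∀ {A A' B B'} → A ≡ A' → B ≡ B' → BA+ Δ ⊢ A ⇒ B → BA+ Δ ⊢ A' ⇒ B'
  ⊢-cong refl refl d = d

  ∧-mono : ∀ {A A' B B'} → BA+ Δ ⊢ A ⇒ A' → BA+ Δ ⊢ B ⇒ B' → BA+ Δ ⊢ A ∧' B ⇒ A' ∧' B'
  ∧-mono p q = ∧I (trans (∧E₁ idax) p) (trans (∧E₂ idax) q)

  ∨-mono : ∀ {A A' B B'} → BA+ Δ ⊢ A ⇒ A' → BA+ Δ ⊢ B ⇒ B' → BA+ Δ ⊢ A ∨' B ⇒ A' ∨' B'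
  ∨-mono p q = ∨I (trans p (∨E₁ idax)) (trans q (∨E₂ idax))

  ∃-mono : ∀ {A A'} → BA+ Δ ⊢ A ⇒ A' → BA+ Δ ⊢ ∃' A ⇒ ∃' A'
  ∃-mono p = ∃I (trans p (∃E idax))

  ⊤⇒⊃-trans : ∀ {X Y Z} → BA+ Δ ⊢ ⊤' ⇒ X ⊃ Y → BA+ Δ ⊢ ⊤' ⇒ Y ⊃ Z → BA+ Δ ⊢ ⊤' ⇒ X ⊃ Z
  ⊤⇒⊃-trans p q = trans (∧I p q) ⊃-trans

  depth-suc⇒depth : ∀ k A → BA+ Δ ⊢ depth (suc k) A ⇒ depth k A
  depth-suc⇒depth k (s ≐ t)         = idax
  depth-suc⇒depth k ⊤'              = idax
  depth-suc⇒depth k ⊥'              = idax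
  depth-suc⇒depth k (A ∧' B)        = ∧-mono (depth-suc⇒depth k A) (depth-suc⇒depth k B)
  depth-suc⇒depth k (A ∨' B)        = ∨-mono (depth-suc⇒depth k A) (depth-suc⇒depth k B)
  depth-suc⇒depth k (∃' A)          = ∃-mono (depth-suc⇒depth k A)
  depth-suc⇒depth k (∀[ n ] A ⟶ B) = ∧E₂ idax

  -- An axiom on implications at depth k + 1 is the axiom itself on the first
  -- conjuncts together with its depth-k instance on the second ones.
  ∧-zip : ∀ {P Q R S P' Q'} → BA+ Δ ⊢ P ∧' R ⇒ P' → BA+ Δ ⊢ Q ∧' S ⇒ Q' →
          BA+ Δ ⊢ (P ∧' Q) ∧' (R ∧' S) ⇒ P' ∧' Q'
  ∧-zip p q = ∧I (trans (∧-mono (∧E₁ idax) (∧E₁ idax)) p)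
                 (trans (∧-mono (∧E₂ idax) (∧E₂ idax)) q)

module _ {Δ Δ' : Sequents} (depth-axioms : ∀ k {s} → Δ s → BA+ Δ' ⊢ depthSeq k s) where

  depth-sound : ∀ k {s} → BA+ Δ ⊢ s → BA+ Δ' ⊢ depthSeq k s
  depth-sound k (hyp h)        = depth-axioms k h
  depth-sound k idax           = idax
  depth-sound k ⊤ax            = ⊤ax
  depth-sound k ⊥ax            = ⊥ax
  depth-sound k distr          = distr
  depth-sound k (frob {A} {B}) =
    ⊢-cong refl (cong (λ X → ∃' (X ∧' depth k B)) (sym (depth-[] k A _))) frob
  depth-sound k eq-refl        = eq-refl
  depth-sound k (eq-sub at-≐)  = eq-sub at-≐
  depth-sound k (eq-sub at-⊤)  = eq-sub at-⊤
  depth-sound k (eq-sub at-⊥)  = eq-sub at-⊥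
  depth-sound zero    ⊃-trans  = ⊤ax
  depth-sound (suc k) ⊃-trans  = ∧-zip ⊃-trans (depth-sound k ⊃-trans)
  depth-sound zero    ⊃-∧      = ⊤ax
  depth-sound (suc k) ⊃-∧      = ∧-zip ⊃-∧ (depth-sound k ⊃-∧)
  depth-sound zero    ⊃-∨      = ⊤ax
  depth-sound (suc k) ⊃-∨      = ∧-zip ⊃-∨ (depth-sound k ⊃-∨)
  depth-sound zero    (⊃-inst τ) = ⊤ax
  depth-sound (suc k) (⊃-inst {n} {A} {B} τ) =
    ∧-mono (⊢-cong refl (sym (cong₂ (∀[_]_⟶_ n) (depth-[] k A _) (depth-[] k B _))) (⊃-inst τ))
           (depth-sound k (⊃-inst τ))
  depth-sound zero    (⊃-rebind m r) = ⊤ax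
  depth-sound (suc k) (⊃-rebind {n} {A} {B} m r) =
    ∧-mono (⊢-cong refl (sym (cong₂ (∀[_]_⟶_ m) (depth-[] k A _) (depth-[] k B _))) (⊃-rebind m r))
           (depth-sound k (⊃-rebind m r))
  depth-sound zero    ⊃-∃ = ⊤ax
  depth-sound (suc k) (⊃-∃ {m} {A} {B}) =
    ∧-mono (⊢-cong (cong (∀[_]_⟶_ (suc m) (depth k B)) (sym (depth-[] k A _))) refl ⊃-∃)
           (depth-sound k ⊃-∃)
  depth-sound k (trans d e)    = trans (depth-sound k d) (depth-sound k e)
  depth-sound k (∧I d e)       = ∧I (depth-sound k d) (depth-sound k e)
  depth-sound k (∧E₁ d)        = ∧E₁ (depth-sound k d)
  depth-sound k (∧E₂ d)        = ∧E₂ (depth-sound k d)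
  depth-sound k (∨I d e)       = ∨I (depth-sound k d) (depth-sound k e)
  depth-sound k (∨E₁ d)        = ∨E₁ (depth-sound k d)
  depth-sound k (∨E₂ d)        = ∨E₂ (depth-sound k d)
  depth-sound k (tsubst {A} {B} j u d) =
    ⊢-cong (sym (depth-[] k A _)) (sym (depth-[] k B _)) (tsubst j u (depth-sound k d))
  depth-sound k (∃I {A} d)     = ∃I (⊢-cong refl (depth-[] k A _) (depth-sound k d))
  depth-sound k (∃E {A} d)     = ⊢-cong refl (sym (depth-[] k A _)) (∃E (depth-sound k d))
  depth-sound zero    (⊃I d)   = ⊤ax
  -- Persistence weakens the depth-(k+1) context to the depth k at which the
  -- premise is translated.
  depth-sound (suc k) (⊃I {n} {A} d) =
    ∧I (⊃I (trans (∧-mono (⊢-cong (depth-[] (suc k) A _) refl (depth-suc⇒depth k (wkN n A))) idax)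
                  (depth-sound k d)))
       (trans (depth-suc⇒depth k A) (depth-sound k (⊃I d)))
  depth-sound k S≢0            = S≢0
  depth-sound k S-inj          = S-inj
  depth-sound k +0             = +0
  depth-sound k +S             = +S
  depth-sound k ·0             = ·0
  depth-sound k ·S             = ·S
  depth-sound zero    ind-ax   = ⊤ax
  depth-sound (suc k) (ind-ax {m} {A}) =
    ∧-mono (⊢-cong (cong (∀[_]_⟶_ (suc m) (depth k A)) (sym (depth-[] k A _)))
                   (cong (λ X → ∀[ suc m ] X ⟶ depth k A) (sym (depth-[] k A _)))
                   ind-ax)
           (depth-sound k ind-ax)
  depth-sound k (ind-rule {A} j d) =
    ⊢-cong (sym (depth-[] k A _)) refl (ind-rule j (⊢-cong refl (depth-[] k A _) (depth-sound k d)))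

^∃s-depth-axioms : (Γ : Sequents) → ∀ k {s} → (Γ ^∃s) s → HA+ (Γ ^∃s) ⊢ depthSeq k s
^∃s-depth-axioms Γ k (pos {A} {B} g) =
  ⊢-cong (sym (depth-^∃ k A)) (sym (depth-^∃ k B)) (hyp (inj₂ (pos g)))

¬x≐0 : Form
¬x≐0 = (var 0 ≐ `0) ⊃ ⊥'

Σ₁-¬x≐0 : Σ₁ ¬x≐0
Σ₁-¬x≐0 = σ-base (d-⊃ (d-at at-≐) (d-at at-⊥))

module _ {Δ : Sequents} where

  ⊤⇒⊤⊃-elim : ∀ {X} → HA+ Δ ⊢ (⊤' ⇒ ⊤' ⊃ X) → HA+ Δ ⊢ (⊤' ⇒ X)
  ⊤⇒⊤⊃-elim p = trans p (hyp (inj₁ ⊤⊃))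

  ¬x≐0-inconsistent : HA+ Δ ⊢ (⊤' ⇒ ¬x≐0) → HA+ Δ ⊢ (⊤' ⇒ ⊥')
  ¬x≐0-inconsistent p = ⊤⇒⊤⊃-elim (⊤⇒⊃-trans ⊤⊃0≐0 (tsubst 0 `0 p))
    where
    ⊤⊃0≐0 : HA+ Δ ⊢ (⊤' ⇒ ⊤' ⊃ (`0 ≐ `0))
    ⊤⊃0≐0 = ⊃I (trans (∧E₁ idax) (tsubst 0 `0 (eq-refl {i = 0})))

  -- At depth 2, ¬x≐0 ⊃ B contributes ⊤ ⊃ B (its depth-0 component) and
  -- B ⊃ ¬x≐0 contributes B ⊃ ¬x≐0⁽¹⁾ (its depth-1 component).
  depth₂-↔-¬x≐0 : ∀ {B} → ∃₁⁺ B → HA+ Δ ⊢ (⊤' ⇒ depth 2 ((¬x≐0 ⊃ B) ∧' (B ⊃ ¬x≐0))) →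
                  HA+ Δ ⊢ (⊤' ⇒ ¬x≐0)
  depth₂-↔-¬x≐0 {B} eB d = ∧E₁ (⊤⇒⊤⊃-elim (⊤⇒⊃-trans ⊤⊃B B⊃¬x≐0⁽¹⁾))
    where
    ⊤⊃B : HA+ Δ ⊢ (⊤' ⇒ ⊤' ⊃ B)
    ⊤⊃B = ⊢-cong refl (cong (⊤' ⊃_) (depth-∃₁⁺ 0 eB)) (∧E₁ (∧E₂ (∧E₁ d)))
    B⊃¬x≐0⁽¹⁾ : HA+ Δ ⊢ (⊤' ⇒ B ⊃ depth 1 ¬x≐0)
    B⊃¬x≐0⁽¹⁾ = ⊢-cong refl (cong (_⊃ depth 1 ¬x≐0) (depth-∃₁⁺ 1 eB)) (∧E₁ (∧E₂ d))

theorem4p2 : (Γ : Sequents) → ¬ (HA+ (Γ ^∃s) ⊢ (⊤' ⇒ ⊥')) →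
    Σ Form (λ A → Σ₁ A × ((B : Form) → ∃₁⁺ B → SameFV A B →
      ¬ (BA+ (Γ ^∃s) ⊢ (⊤' ⇒ (A ⊃ B) ∧' (B ⊃ A)))))
theorem4p2 Γ consistent = ¬x≐0 , Σ₁-¬x≐0 , refute
  where
  refute : (B : Form) → ∃₁⁺ B → SameFV ¬x≐0 B →
           ¬ (BA+ (Γ ^∃s) ⊢ (⊤' ⇒ (¬x≐0 ⊃ B) ∧' (B ⊃ ¬x≐0)))
  refute B eB _ d =
    consistent (¬x≐0-inconsistent (depth₂-↔-¬x≐0 eB (depth-sound (^∃s-depth-axioms Γ) 2 d)))
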